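{- Let $k\ge 2$ and let $a_1,\ldots,a_k,b$ be integers with $a_1,\ldots,a_k\ge b>0$. There is a 2-coloring of the edges of the complete graph on the positive integers such that for every solution of $a_1x_1+\cdots+a_kx_k=bz$ in pairwise distinct positive integers $x_1,\ldots,x_k,z$, the edges $\{x_i,z\}$ ($i=1,\ldots,k$) are not all of the same color; in particular the complete graph on $\{x_1,\ldots,x_k,z\}$ is not monochromatic. -}

module Defs where

open import Data.Nat using (ℕ; zero; suc; _+_; _*_)
open import Data.Fin using (Fin; zero; suc)

sumFin : (k : ℕ) → (Fin k → ℕ) → ℕ
sumFin zero    f = 0
sumFin (suc k) f = f zero + sumFin k (λ i → f (suc i))

-- Colour an edge {x, y} red when one endpoint exceeds A/b times the other, where
-- A = a₁ + ⋯ + aₖ.  If a₁x₁ + ⋯ + aₖxₖ = bz, then bz/A is the weighted mean of the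
-- xᵢ with weights aᵢ, and bxᵢ ≤ aᵢxᵢ ≤ bz shows that no xᵢ exceeds z by that factor.
-- So {xᵢ, z} is red iff xᵢ lies strictly below the mean.  Not every xᵢ lies below
-- its weighted mean, and if none does then all of them equal it, contradicting
-- distinctness.
module Submission where

open import Defs
open import Data.Nat using (ℕ; zero; suc; _+_; _*_; _≤_; _<_; _<ᵇ_; z≤n; s≤s; >-nonZero)
open import Data.Nat.Properties
open import Data.Fin using (Fin; zero; suc)
open import Data.Fin.Properties using () renaming (0≢1+n to zero≢suc)
open import Data.Bool using (Bool; true; false; _∨_; T)
open import Data.Bool.Properties using (∨-comm; ∨-identityʳ)
open import Data.Product using (Σ; ∃; _×_; _,_)
open import Relation.Binary.PropositionalEquality
open import Relation.Nullary using (¬_; contradiction)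
open import Function using (_∘_)
open import Algebra.Properties.CommutativeSemigroup *-commutativeSemigroup using (x∙yz≈y∙xz)

sumFin-cong : ∀ k {f g : Fin k → ℕ} → (∀ i → f i ≡ g i) → sumFin k f ≡ sumFin k g
sumFin-cong zero    f≡g = refl
sumFin-cong (suc k) f≡g = cong₂ _+_ (f≡g zero) (sumFin-cong k (λ i → f≡g (suc i)))

sumFin-*ˡ : ∀ k m (f : Fin k → ℕ) → sumFin k (λ i → m * f i) ≡ m * sumFin k f
sumFin-*ˡ zero    m f = sym (*-zeroʳ m)
sumFin-*ˡ (suc k) m f = begin
  m * f zero + sumFin k (λ i → m * f (suc i))  ≡⟨ cong (m * f zero +_) (sumFin-*ˡ k m (λ i → f (suc i))) ⟩
  m * f zero + m * sumFin k (λ i → f (suc i))  ≡⟨ *-distribˡ-+ m (f zero) _ ⟨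
  m * sumFin (suc k) f                         ∎
  where open ≡-Reasoning

sumFin-*ʳ : ∀ k (f : Fin k → ℕ) m → sumFin k (λ i → f i * m) ≡ sumFin k f * m
sumFin-*ʳ k f m = begin
  sumFin k (λ i → f i * m)  ≡⟨ sumFin-cong k (λ i → *-comm (f i) m) ⟩
  sumFin k (λ i → m * f i)  ≡⟨ sumFin-*ˡ k m f ⟩
  m * sumFin k f            ≡⟨ *-comm m _ ⟩
  sumFin k f * m            ∎
  where open ≡-Reasoning

≤-sumFin : ∀ k (f : Fin k → ℕ) j → f j ≤ sumFin k f
≤-sumFin (suc k) f zero    = m≤m+n _ _
≤-sumFin (suc k) f (suc j) = ≤-trans (≤-sumFin k (λ i → f (suc i)) j) (m≤n+m _ _)

sumFin-mono-≤ : ∀ k {f g : Fin k → ℕ} → (∀ i → f i ≤ g i) → sumFin k f ≤ sumFin k g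
sumFin-mono-≤ zero    f≤g = z≤n
sumFin-mono-≤ (suc k) f≤g = +-mono-≤ (f≤g zero) (sumFin-mono-≤ k (λ i → f≤g (suc i)))

sumFin-mono-< : ∀ k {f g : Fin k → ℕ} → (∀ i → f i ≤ g i) → ∀ j → f j < g j →
                sumFin k f < sumFin k g
sumFin-mono-< (suc k) f≤g zero    fj<gj = +-mono-<-≤ fj<gj (sumFin-mono-≤ k (λ i → f≤g (suc i)))
sumFin-mono-< (suc k) f≤g (suc j) fj<gj =
  +-mono-≤-< (f≤g zero) (sumFin-mono-< k (λ i → f≤g (suc i)) j fj<gj)

-- With total weight A = Σ aᵢ and weighted sum S = Σ aᵢxᵢ, the weighted mean of the xᵢ is
-- S / A; comparing A * xᵢ with S compares xᵢ with the mean without division.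
module WeightedMean {k} (a x : Fin k → ℕ) where

  A S : ℕ
  A = sumFin k a
  S = sumFin k (λ i → a i * x i)

  weightedSum-scaled : sumFin k (λ i → a i * (A * x i)) ≡ A * S
  weightedSum-scaled = trans (sumFin-cong k (λ i → x∙yz≈y∙xz (a i) A (x i)))
                             (sumFin-*ˡ k A (λ i → a i * x i))

  weightedSum-mean : sumFin k (λ i → a i * S) ≡ A * S
  weightedSum-mean = sumFin-*ʳ k a S

  module _ (a>0 : ∀ i → 0 < a i) where

    private
      a*-mono-< : ∀ i {m n} → m < n → a i * m < a i * n
      a*-mono-< i = *-monoʳ-< (a i) {{>-nonZero (a>0 i)}}

    ¬all-below-mean : Fin k → ¬ (∀ i → A * x i < S)
    ¬all-below-mean j below = <-irrefl refl (begin-strict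
      A * S                             ≡⟨ weightedSum-scaled ⟨
      sumFin k (λ i → a i * (A * x i))  <⟨ sumFin-mono-< k (λ i → <⇒≤ (a*-mono-< i (below i))) j
                                                           (a*-mono-< j (below j)) ⟩
      sumFin k (λ i → a i * S)          ≡⟨ weightedSum-mean ⟩
      A * S                             ∎)
      where open ≤-Reasoning

    all-above-mean⇒at-mean : (∀ i → S ≤ A * x i) → ∀ j → A * x j ≡ S
    all-above-mean⇒at-mean above j = ≤-antisym (≮⇒≥ above-j) (above j)
      where
      open ≤-Reasoning
      above-j : ¬ S < A * x j
      above-j S<Axj = <-irrefl refl (begin-strict
        A * S                             ≡⟨ weightedSum-mean ⟨
        sumFin k (λ i → a i * S)          <⟨ sumFin-mono-< k (λ i → *-monoʳ-≤ (a i) (above i)) j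
                                                             (a*-mono-< j S<Axj) ⟩
        sumFin k (λ i → a i * (A * x i))  ≡⟨ weightedSum-scaled ⟩
        A * S                             ∎)

spreadColouring : ℕ → ℕ → ℕ → ℕ → Bool
spreadColouring A b x y = (A * x <ᵇ b * y) ∨ (A * y <ᵇ b * x)

spreadColouring-sym : ∀ A b x y → spreadColouring A b x y ≡ spreadColouring A b y x
spreadColouring-sym A b x y = ∨-comm (A * x <ᵇ b * y) (A * y <ᵇ b * x)

spreadColouring-below : ∀ A b x y → b * x ≤ A * y → spreadColouring A b x y ≡ (A * x <ᵇ b * y)
spreadColouring-below A b x y bx≤Ay with A * y <ᵇ b * x in Ay<ᵇbx
... | false = ∨-identityʳ _
... | true  = contradiction (<ᵇ⇒< _ _ (subst T (sym Ay<ᵇbx) _)) (≤⇒≯ bx≤Ay)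

spreadColouring-noMonochromaticStar :
  ∀ {k} (a x : Fin (suc (suc k)) → ℕ) b z → 0 < b → (∀ i → b ≤ a i) →
  x zero ≢ x (suc zero) → sumFin _ (λ i → a i * x i) ≡ b * z →
  ¬ (∃ λ col → ∀ i → spreadColouring (sumFin _ a) b (x i) z ≡ col)
spreadColouring-noMonochromaticStar a x b z b>0 b≤a x₀≢x₁ S≡bz (col , star) = monochromatic col star
  where
  open WeightedMean a x

  a>0 : ∀ i → 0 < a i
  a>0 i = <-≤-trans b>0 (b≤a i)

  A>0 : 0 < A
  A>0 = <-≤-trans (a>0 zero) (≤-sumFin _ a zero)

  bx≤Az : ∀ i → b * x i ≤ A * z
  bx≤Az i = begin
    b * x i    ≤⟨ *-monoˡ-≤ (x i) (b≤a i) ⟩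
    a i * x i  ≤⟨ ≤-sumFin _ (λ j → a j * x j) i ⟩
    S          ≡⟨ S≡bz ⟩
    b * z      ≤⟨ *-monoˡ-≤ z (≤-trans (b≤a zero) (≤-sumFin _ a zero)) ⟩
    A * z      ∎
    where open ≤-Reasoning

  colour : ∀ i → spreadColouring A b (x i) z ≡ (A * x i <ᵇ S)
  colour i = trans (spreadColouring-below A b (x i) z (bx≤Az i)) (cong (A * x i <ᵇ_) (sym S≡bz))

  monochromatic : ∀ col → ¬ (∀ i → spreadColouring A b (x i) z ≡ col)
  monochromatic true  star = ¬all-below-mean a>0 zero below
    where
    below : ∀ i → A * x i < S
    below i = <ᵇ⇒< _ _ (subst T (trans (sym (star i)) (colour i)) _)
  monochromatic false star =
    x₀≢x₁ (*-cancelˡ-≡ _ _ A {{>-nonZero A>0}} (trans (at-mean zero) (sym (at-mean (suc zero)))))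
    where
    at-mean : ∀ j → A * x j ≡ S
    at-mean = all-above-mean⇒at-mean a>0 above
      where
      above : ∀ i → S ≤ A * x i
      above i = ≮⇒≥ (λ lt → subst T (trans (sym (colour i)) (star i)) (<⇒<ᵇ lt))

mainTheorem7 : (k : ℕ) → 2 ≤ k → (a : Fin k → ℕ) → (b : ℕ) → 0 < b → (∀ i → b ≤ a i) →
    Σ (ℕ → ℕ → Bool) λ c →
      (∀ x y → c x y ≡ c y x) ×
      ((x : Fin k → ℕ) → (z : ℕ) →
        (∀ i → 0 < x i) → 0 < z →
        (∀ i j → x i ≡ x j → i ≡ j) → (∀ i → x i ≢ z) →
        sumFin k (λ i → a i * x i) ≡ b * z →
        ¬ (∃ λ (col : Bool) → ∀ i → c (x i) z ≡ col))
mainTheorem7 (suc (suc k)) (s≤s (s≤s z≤n)) a b b>0 b≤a =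
  spreadColouring A b , spreadColouring-sym A b ,
  λ x z _ _ x-injective _ →
    spreadColouring-noMonochromaticStar a x b z b>0 b≤a (zero≢suc ∘ x-injective zero (suc zero))
  where
  A : ℕ
  A = sumFin (suc (suc k)) a
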